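{- Let $M$ be an $\mathcal{L}$-structure with a disjoint pre-coding configuration given by a quasi-positive formula $\phi(\bar x,\bar y,z)$. Then there are $x_0\in\bar x$ and $y_0\in\bar y$ such that there is a path from $x_0$ to $y_0$ in $\mathsf{Gaif}(\mathcal{M}_{\tilde\phi})$ that does not pass through the parameters of $\phi$.
   Context: Formulas may contain finitely many parameters (constants), treated syntactically as extra free variables (so they are vertices of canonical structures) with a fixed interpretation in each structure. A formula is quasi-positive if it has the form $\exists\bar w\,\psi$ where $\psi$ is a conjunction of atomic formulas and formulas $v_i\neq v_j$ between variables. For quasi-positive $\phi$, $\tilde\phi$ is obtained by deleting all conjuncts $v_i\neq v_j$ from $\psi$; $\mathcal{M}_{\tilde\phi}$ is its canonical structure: domain the variables of $\tilde\phi$, with $R(\bar v)$ holding iff it is a conjunct. $\mathsf{Gaif}(N)$ is the graph on $N$ in which distinct elements are adjacent iff they occur together in some tuple of some relation. A pre-coding configuration in an (infinite) $\mathcal{L}$-structure $M$ consists of a formula $\phi(\bar x,\bar y,z)$ with parameters, a sequence $(\bar d_i)_{i\in\mathbb{N}}$ and elements $\{c_{s,t}:s,t\in\mathbb{N}\}$ such that for all $s,t$: $M\models\phi(\bar d_s,\bar d_t,c_{s,t})$; $M\models\neg\phi(\bar d_s,\bar d_v,c_{s,t})$ for all $v>t$; and $M\models\neg\phi(\bar d_u,\bar d_t,c_{s,t})$ for all $u<s$. If $\phi=\exists\bar w\,\psi(\bar x,\bar y,z,\bar w)$, the configuration is disjoint if there are tuples $\bar h_{s,t}$ with $M\models\psi(\bar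 d_s,\bar d_t,c_{s,t},\bar h_{s,t})$ such that any two distinct members of $\{\bar d_s,c_{s,t},\bar h_{s,t}:s,t\in\mathbb{N}\}$ are disjoint and none meets the parameters of $\phi$. -}

module Defs where

open import Data.Nat using (ℕ; _<_)
open import Data.Fin using (Fin)
open import Data.Vec using (Vec; map)
open import Data.Vec.Membership.Propositional using (_∈_)
open import Data.List using (List)
open import Data.List.Relation.Unary.Any using (Any)
open import Data.List.Relation.Unary.All using (All)
open import Data.Product using (Σ; _×_; _,_; ∃; proj₁; proj₂)
open import Data.Empty using (⊥)
open import Data.Unit using (⊤)
open import Relation.Nullary using (¬_)
open import Relation.Binary.PropositionalEquality using (_≡_; _≢_)

record Language : Set₁ where
  field
    Sym : Set
    ar  : Sym → ℕ

record Structure (L : Language) : Set₁ where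
  open Language L
  field
    Carrier : Set
    rel     : (R : Sym) → Vec Carrier (ar R) → Set

-- Variables of a formula φ(x̄, ȳ, z) = ∃ w̄ ψ(x̄, ȳ, z, w̄) with
-- parameters p̄.  |x̄| = |ȳ| = n, |w̄| = k, number of parameters = l.
-- Parameters are treated syntactically as extra free variables.

data Var (n k l : ℕ) : Set where
  xv : Fin n → Var n k l
  yv : Fin n → Var n k l
  zv : Var n k l
  wv : Fin k → Var n k l
  pv : Fin l → Var n k l

IsParam : ∀ {n k l} → Var n k l → Set
IsParam (pv _) = ⊤
IsParam _      = ⊥

-- Quasi-positive formulas  ∃ w̄ ψ,  ψ a conjunction of atomic formulas
-- R(v̄) and inequalities v ≠ v' between variables.

module _ (L : Language) where
  open Language L

  Atom : (n k l : ℕ) → Set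
  Atom n k l = Σ Sym (λ R → Vec (Var n k l) (ar R))

  record QPFormula (n k l : ℕ) : Set where
    field
      atoms : List (Atom n k l)
      neqs  : List (Var n k l × Var n k l)

module _ {L : Language} where
  open Language L

  module _ (M : Structure L) where
    open Structure M

    assign : ∀ {n k l} → Vec Carrier n → Vec Carrier n → Carrier →
             Vec Carrier k → Vec Carrier l → Var n k l → Carrier
    assign a b c h p (xv i) = Data.Vec.lookup a i
    assign a b c h p (yv i) = Data.Vec.lookup b i
    assign a b c h p zv     = c
    assign a b c h p (wv i) = Data.Vec.lookup h i
    assign a b c h p (pv i) = Data.Vec.lookup p i

    Satψ : ∀ {n k l} → QPFormula L n k l → Vec Carrier l →
           Vec Carrier n → Vec Carrier n → Carrier → Vec Carrier k → Set
    Satψ φ p a b c h =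
      All (λ at → rel (proj₁ at) (map σ (proj₂ at))) (QPFormula.atoms φ)
      × All (λ uv → σ (proj₁ uv) ≢ σ (proj₂ uv)) (QPFormula.neqs φ)
      where σ = assign a b c h p

    Satφ : ∀ {n k l} → QPFormula L n k l → Vec Carrier l →
           Vec Carrier n → Vec Carrier n → Carrier → Set
    Satφ {k = k} φ p a b c = Σ (Vec Carrier k) (λ h → Satψ φ p a b c h)

    PreCoding : ∀ {n k l} → QPFormula L n k l → Vec Carrier l →
                (ℕ → Vec Carrier n) → (ℕ → ℕ → Carrier) → Set
    PreCoding φ p d c =
      (∀ s t → Satφ φ p (d s) (d t) (c s t))
      × (∀ s t v → t < v → ¬ Satφ φ p (d s) (d v) (c s t))
      × (∀ s t u → u < s → ¬ Satφ φ p (d u) (d t) (c s t))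

    data Member : Set where
      dM : ℕ → Member
      cM : ℕ → ℕ → Member
      hM : ℕ → ℕ → Member

    Occurs : ∀ {n k} → (ℕ → Vec Carrier n) → (ℕ → ℕ → Carrier) →
             (ℕ → ℕ → Vec Carrier k) → Carrier → Member → Set
    Occurs d c h e (dM s)   = e ∈ d s
    Occurs d c h e (cM s t) = e ≡ c s t
    Occurs d c h e (hM s t) = e ∈ h s t

    DisjointWitnesses : ∀ {n k l} → QPFormula L n k l → Vec Carrier l →
                        (ℕ → Vec Carrier n) → (ℕ → ℕ → Carrier) → Set
    DisjointWitnesses {n} {k} φ p d c =
      Σ (ℕ → ℕ → Vec Carrier k) λ h →
        (∀ s t → Satψ φ p (d s) (d t) (c s t) (h s t))
        × (∀ m m' → m ≢ m' → ∀ e → Occurs d c h e m → Occurs d c h e m' → ⊥)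
        × (∀ m e → Occurs d c h e m → e ∈ p → ⊥)

  -- Gaifman graph of the canonical structure M_φ̃ (the inequality
  -- conjuncts are dropped): distinct variables u, v are adjacent iff
  -- they occur together in some atomic conjunct of ψ.

  Adj : ∀ {n k l} → QPFormula L n k l → Var n k l → Var n k l → Set
  Adj φ u v = u ≢ v × Any (λ at → u ∈ proj₂ at × v ∈ proj₂ at) (QPFormula.atoms φ)

  data ParamFreePath {n k l} (φ : QPFormula L n k l) :
       Var n k l → Var n k l → Set where
    here  : ∀ {v} → ¬ IsParam v → ParamFreePath φ v v
    step  : ∀ {u v w} → ¬ IsParam u → Adj φ u v →
            ParamFreePath φ v w → ParamFreePath φ u w

-- Let S be the set of variables reachable from x̄ in Gaif(M_φ̃) along paths avoiding
-- the parameters. If S met ȳ we would be done, so suppose it does not. Then S separates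
-- x̄ from ȳ, and every atomic conjunct of ψ meeting S has all its non-parameter
-- variables in S. Splice the witnesses for (s,t) = (0,0) and (1,1): use the first on S
-- and the second off S. Atoms are satisfied because each is evaluated entirely by one
-- of the two witnesses (the parameters being shared), and inequalities survive because
-- the configuration is disjoint. The spliced tuple witnesses φ(d̄₀, d̄₁, c), where c is
-- c₀,₀ or c₁,₁ according as z ∈ S; either way this contradicts the pre-coding
-- conditions.
module Submission where

open import Defs
open import Data.Nat using (ℕ; zero; suc; _+_; z<s)
open import Data.Fin using (Fin; zero; suc)
import Data.Fin.Properties as Fin
open import Data.Vec using (Vec; []; _∷_; map; lookup; tabulate; allFin; _++_; removeAt)
open import Data.Vec.Properties using (lookup∘tabulate)
open import Data.Vec.Relation.Unary.Any using (here; there)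
import Data.Vec.Relation.Unary.Any as VecAny
open import Data.Vec.Relation.Unary.Any.Properties using (lookup-index)
open import Data.Vec.Membership.Propositional using () renaming (_∈_ to _∈ᵥ_)
import Data.Vec.Membership.Propositional as VecMem
open import Data.Vec.Membership.Propositional.Properties
  using (∈-lookup; ∈-map⁺; ∈-++⁺ˡ; ∈-++⁺ʳ; ∈-allFin⁺)
open import Data.List using (List; _∷_)
import Data.List as List
open import Data.List.Relation.Unary.Any using (any?)
import Data.List.Relation.Unary.Any as ListAny
open import Data.List.Relation.Unary.All using (All; _∷_)
import Data.List.Relation.Unary.All as All
import Data.List.Relation.Unary.All.Properties as AllP
import Data.List.Membership.DecPropositional as DecMem
open import Data.List.Membership.Propositional using (_∈_; lose; find)
import Data.List.Membership.Propositional.Properties as ListMem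
open import Data.List.Relation.Binary.Subset.Propositional using (_⊆_)
open import Data.Product using (Σ; ∃; _×_; _,_; proj₁; proj₂)
open import Data.Sum using (_⊎_; inj₁; inj₂; [_,_]′)
import Data.Sum as Sum
open import Data.Sum.Properties using (≡-dec)
open import Data.Empty using (⊥; ⊥-elim)
open import Data.Unit using (⊤; tt)
import Data.Unit.Properties as Unit
open import Data.Bool using (if_then_else_)
open import Function using (_∘_; id)
open import Relation.Nullary using (¬_; Dec; yes; no; does; contradiction)
open import Relation.Nullary.Decidable using (dec-true; dec-false)
import Relation.Nullary.Decidable as Dec
open import Relation.Unary using (Decidable)
open import Relation.Binary.Definitions using (DecidableEquality)
open import Relation.Binary.PropositionalEquality
  using (_≡_; _≢_; refl; sym; trans; cong; cong₂; subst)

∈-removeAt : ∀ {A : Set} {m} (xs : Vec A (suc m)) (i : Fin (suc m)) {w} →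
             w ∈ᵥ xs → w ≡ lookup xs i ⊎ w ∈ᵥ removeAt xs i
∈-removeAt (x ∷ xs)     zero    (here w≡x)  = inj₁ w≡x
∈-removeAt (x ∷ xs)     zero    (there w∈)  = inj₂ w∈
∈-removeAt (x ∷ y ∷ xs) (suc i) (here w≡x)  = inj₂ (here w≡x)
∈-removeAt (x ∷ y ∷ xs) (suc i) (there w∈)  = Sum.map₂ there (∈-removeAt (y ∷ xs) i w∈)

map-cong-∈ : ∀ {A B : Set} {m} {f g : A → B} {xs : Vec A m} →
             (∀ {x} → x ∈ᵥ xs → f x ≡ g x) → map f xs ≡ map g xs
map-cong-∈ {xs = []}     f≡g = refl
map-cong-∈ {xs = x ∷ xs} f≡g = cong₂ _∷_ (f≡g (here refl)) (map-cong-∈ (f≡g ∘ there))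

record ClosedExtension {V : Set} (E : V → V → Set) (P : V → Set) (seeds : List V) : Set where
  field
    members        : List V
    members-sat    : All P members
    seeds⊆members  : seeds ⊆ members
    members-closed : ∀ {u v} → u ∈ members → E u v → v ∈ members

module _ {V : Set} {E : V → V → Set} (E? : ∀ u v → Dec (E u v))
         {P : V → Set} (P-step : ∀ {u v} → P u → E u v → P v) where

  -- Invariant: every vertex is in rest or visited. Each round moves one vertex with an
  -- edge from the visited part out of rest, so the recursion is on the length of rest.
  closedExtension : ∀ {m} (rest : Vec V m) (visited : List V) →
                    (∀ v → v ∈ᵥ rest ⊎ v ∈ visited) → All P visited →
                    ClosedExtension E P visited
  closedExtension {zero} [] visited covers sat = record
    { members        = visited
    ; members-sat    = sat
    ; seeds⊆members  = id
    ; members-closed = λ {_} {v} _ _ → [ (λ ()) , id ]′ (covers v)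
    }
  closedExtension {suc m} rest visited covers sat
    with VecAny.any? (λ v → any? (λ u → E? u v) visited) rest
  ... | no no-frontier = record
    { members        = visited
    ; members-sat    = sat
    ; seeds⊆members  = id
    ; members-closed = λ {u} {v} u∈ e →
        [ (λ v∈rest → contradiction (VecMem.lose v∈rest (lose u∈ e)) no-frontier) , id ]′
        (covers v)
    }
  ... | yes frontier = record
    { ClosedExtension extension hiding (seeds⊆members)
    ; seeds⊆members = ClosedExtension.seeds⊆members extension ∘ ListAny.there
    }
    where
      i : Fin (suc m)
      i = VecAny.index frontier

      v : V
      v = lookup rest i

      v-sat : P v
      v-sat with find (lookup-index frontier)
      ... | u , u∈ , e = P-step (All.lookup sat u∈) e

      covers′ : ∀ w → w ∈ᵥ removeAt rest i ⊎ w ∈ v ∷ visited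
      covers′ w = [ [ inj₂ ∘ ListAny.here , inj₁ ]′ ∘ ∈-removeAt rest i , inj₂ ∘ ListAny.there ]′
                  (covers w)

      extension : ClosedExtension E P (v ∷ visited)
      extension = closedExtension (removeAt rest i) (v ∷ visited) covers′ (v-sat ∷ sat)

module _ {n k l : ℕ} where

  private
    Code : Set
    Code = Fin n ⊎ Fin n ⊎ ⊤ ⊎ Fin k ⊎ Fin l

    encode : Var n k l → Code
    encode (xv i) = inj₁ i
    encode (yv i) = inj₂ (inj₁ i)
    encode zv     = inj₂ (inj₂ (inj₁ tt))
    encode (wv i) = inj₂ (inj₂ (inj₂ (inj₁ i)))
    encode (pv i) = inj₂ (inj₂ (inj₂ (inj₂ i)))

    decode : Code → Var n k l
    decode = [ xv , [ yv , [ (λ _ → zv) , [ wv , pv ]′ ]′ ]′ ]′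

    decode-encode : ∀ v → decode (encode v) ≡ v
    decode-encode (xv _) = refl
    decode-encode (yv _) = refl
    decode-encode zv     = refl
    decode-encode (wv _) = refl
    decode-encode (pv _) = refl

    encode-injective : ∀ {u v} → encode u ≡ encode v → u ≡ v
    encode-injective {u} {v} eq =
      trans (sym (decode-encode u)) (trans (cong decode eq) (decode-encode v))

    _≟C_ : DecidableEquality Code
    _≟C_ = ≡-dec Fin._≟_ (≡-dec Fin._≟_ (≡-dec Unit._≟_ (≡-dec Fin._≟_ Fin._≟_)))

  _≟V_ : DecidableEquality (Var n k l)
  u ≟V v = Dec.map′ encode-injective (cong encode) (encode u ≟C encode v)

  isParam? : (v : Var n k l) → Dec (IsParam v)
  isParam? (xv _) = no λ ()
  isParam? (yv _) = no λ ()
  isParam? zv     = no λ ()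
  isParam? (wv _) = no λ ()
  isParam? (pv _) = yes tt

  private
    xs ys : Vec (Var n k l) n
    xs = map xv (allFin n)
    ys = map yv (allFin n)
    ws : Vec (Var n k l) k
    ws = map wv (allFin k)
    ps : Vec (Var n k l) l
    ps = map pv (allFin l)

  allVars : Vec (Var n k l) (n + (n + (1 + (k + l))))
  allVars = xs ++ ys ++ zv ∷ ws ++ ps

  ∈-allVars : ∀ v → v ∈ᵥ allVars
  ∈-allVars (xv i) = ∈-++⁺ˡ (∈-map⁺ xv (∈-allFin⁺ i))
  ∈-allVars (yv i) = ∈-++⁺ʳ xs (∈-++⁺ˡ (∈-map⁺ yv (∈-allFin⁺ i)))
  ∈-allVars zv     = ∈-++⁺ʳ xs (∈-++⁺ʳ ys (here refl))
  ∈-allVars (wv i) = ∈-++⁺ʳ xs (∈-++⁺ʳ ys (there (∈-++⁺ˡ (∈-map⁺ wv (∈-allFin⁺ i)))))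
  ∈-allVars (pv i) = ∈-++⁺ʳ xs (∈-++⁺ʳ ys (there (∈-++⁺ʳ ws (∈-map⁺ pv (∈-allFin⁺ i)))))

module _ {L : Language} {n k l : ℕ} {φ : QPFormula L n k l} where

  adj? : ∀ u v → Dec (Adj φ u v)
  adj? u v = Dec.¬? (u ≟V v) Dec.×-dec
             any? (λ at → VecAny.any? (u ≟V_) (proj₂ at) Dec.×-dec VecAny.any? (v ≟V_) (proj₂ at))
                  (QPFormula.atoms φ)

  ParamFreePath-snoc : ∀ {a u v} → ParamFreePath φ a u → Adj φ u v → ¬ IsParam v →
                       ParamFreePath φ a v
  ParamFreePath-snoc (here ¬pu)       u~v ¬pv = step ¬pu u~v (here ¬pv)
  ParamFreePath-snoc (step ¬pa a~b r) u~v ¬pv = step ¬pa a~b (ParamFreePath-snoc r u~v ¬pv)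

  ParamFreePath-target : ∀ {a v} → ParamFreePath φ a v → ¬ IsParam v
  ParamFreePath-target (here ¬pv)   = ¬pv
  ParamFreePath-target (step _ _ r) = ParamFreePath-target r

module _ {L : Language} (M : Structure L) {n k l : ℕ} (φ : QPFormula L n k l) where
  open Structure M

  -- Satψ M φ p a b c h unfolds to Holds (assign M a b c h p).
  Holds : (Var n k l → Carrier) → Set
  Holds σ = All (λ at → rel (proj₁ at) (map σ (proj₂ at))) (QPFormula.atoms φ)
          × All (λ uv → σ (proj₁ uv) ≢ σ (proj₂ uv)) (QPFormula.neqs φ)

  module _ {S : Var n k l → Set} (S? : Decidable S)
           (S-closed : ∀ {u v} → S u → Adj φ u v → ¬ IsParam v → S v)
           {σ₀ σ₁ τ : Var n k l → Carrier}
           (params-agree : ∀ {v} → IsParam v → σ₀ v ≡ σ₁ v)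
           (separated : ∀ {u v} → S u → ¬ S v → σ₀ u ≢ σ₁ v)
           (τ≡σ₀ : ∀ {v} → S v → τ v ≡ σ₀ v)
           (τ≡σ₁ : ∀ {v} → ¬ S v → τ v ≡ σ₁ v) where

    splice-atom : ∀ {R vs} → (R , vs) ∈ QPFormula.atoms φ →
                  rel R (map σ₀ vs) → rel R (map σ₁ vs) → rel R (map τ vs)
    splice-atom {R} {vs} at∈ R₀ R₁ with VecAny.any? S? vs
    ... | no avoids = subst (rel R) (sym (map-cong-∈ λ v∈ → τ≡σ₁ (avoids ∘ VecMem.lose v∈))) R₁
    ... | yes meets with VecMem.find meets
    ...   | u , u∈ , Su = subst (rel R) (sym (map-cong-∈ τ≡σ₀-on-atom)) R₀
      where
        τ≡σ₀-on-atom : ∀ {v} → v ∈ᵥ vs → τ v ≡ σ₀ v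
        τ≡σ₀-on-atom {v} v∈ with S? v | isParam? v
        ... | yes Sv | _         = τ≡σ₀ Sv
        ... | no ¬Sv | yes param = trans (τ≡σ₁ ¬Sv) (sym (params-agree param))
        ... | no ¬Sv | no ¬param =
          contradiction (S-closed Su ((λ { refl → ¬Sv Su }) , lose at∈ (u∈ , v∈)) ¬param) ¬Sv

    splice-neq : ∀ {u v} → σ₀ u ≢ σ₀ v → σ₁ u ≢ σ₁ v → τ u ≢ τ v
    splice-neq {u} {v} ne₀ ne₁ τu≡τv with S? u | S? v
    ... | yes Su | yes Sv = ne₀ (trans (sym (τ≡σ₀ Su)) (trans τu≡τv (τ≡σ₀ Sv)))
    ... | no ¬Su | no ¬Sv = ne₁ (trans (sym (τ≡σ₁ ¬Su)) (trans τu≡τv (τ≡σ₁ ¬Sv)))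
    ... | yes Su | no ¬Sv = separated Su ¬Sv (trans (sym (τ≡σ₀ Su)) (trans τu≡τv (τ≡σ₁ ¬Sv)))
    ... | no ¬Su | yes Sv = separated Sv ¬Su (trans (sym (τ≡σ₀ Sv)) (trans (sym τu≡τv) (τ≡σ₁ ¬Su)))

    splice-holds : Holds σ₀ → Holds σ₁ → Holds τ
    splice-holds (atoms₀ , neqs₀) (atoms₁ , neqs₁) =
      All.tabulate (λ at∈ → splice-atom at∈ (All.lookup atoms₀ at∈) (All.lookup atoms₁ at∈)) ,
      All.tabulate (λ uv∈ → splice-neq (All.lookup neqs₀ uv∈) (All.lookup neqs₁ uv∈))

stage : ∀ {L} {M : Structure L} → Member M → ℕ
stage (dM s)   = s
stage (cM s _) = s
stage (hM s _) = s

module _ {L : Language} (M : Structure L) {n k l : ℕ} (p : Vec (Structure.Carrier M) l)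
         (d : ℕ → Vec (Structure.Carrier M) n) (c : ℕ → ℕ → Structure.Carrier M)
         (h : ℕ → ℕ → Vec (Structure.Carrier M) k) where
  open Structure M

  diagonal : ℕ → Var n k l → Carrier
  diagonal s = assign M (d s) (d s) (c s s) (h s s) p

  diagonal-occurs : ∀ s {u} → ¬ IsParam u →
                    Σ (Member M) λ m → stage m ≡ s × Occurs M d c h (diagonal s u) m
  diagonal-occurs s {xv i} _      = dM s , refl , ∈-lookup i (d s)
  diagonal-occurs s {yv i} _      = dM s , refl , ∈-lookup i (d s)
  diagonal-occurs s {zv}   _      = cM s s , refl , refl
  diagonal-occurs s {wv i} _      = hM s s , refl , ∈-lookup i (h s s)
  diagonal-occurs s {pv _} ¬param = ⊥-elim (¬param tt)

  diagonal-param : ∀ s {v} → IsParam v → diagonal s v ∈ᵥ p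
  diagonal-param s {pv i} _ = ∈-lookup i p

  diagonals-disjoint :
    (∀ m m' → m ≢ m' → ∀ e → Occurs M d c h e m → Occurs M d c h e m' → ⊥) →
    (∀ m e → Occurs M d c h e m → e ∈ᵥ p → ⊥) →
    ∀ {s s'} → s ≢ s' → ∀ {u v} → ¬ IsParam u → diagonal s u ≢ diagonal s' v
  diagonals-disjoint disjoint avoids-p {s} {s'} s≢s' {v = v} ¬pu su≡s'v
    with diagonal-occurs s ¬pu | isParam? v
  ... | m , _ , u-occ | yes param =
    avoids-p m _ u-occ (subst (_∈ᵥ p) (sym su≡s'v) (diagonal-param s' param))
  ... | m , m-stage , u-occ | no ¬pv with diagonal-occurs s' ¬pv
  ...   | m' , m'-stage , v-occ =
    disjoint m m' (λ m≡m' → s≢s' (trans (sym m-stage) (trans (cong stage m≡m') m'-stage)))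
             _ u-occ (subst (λ e → Occurs M d c h e m') (sym su≡s'v) v-occ)

record Separator {L : Language} {n k l : ℕ} (φ : QPFormula L n k l) : Set₁ where
  field
    S              : Var n k l → Set
    S?             : Decidable S
    x∈S            : ∀ i → S (xv i)
    y∉S            : ∀ j → ¬ S (yv j)
    S-params-free  : ∀ {v} → S v → ¬ IsParam v
    S-closed       : ∀ {u v} → S u → Adj φ u v → ¬ IsParam v → S v

module _ {L : Language} (M : Structure L) {n k l : ℕ} (φ : QPFormula L n k l)
         (p : Vec (Structure.Carrier M) l) (d : ℕ → Vec (Structure.Carrier M) n)
         (c : ℕ → ℕ → Structure.Carrier M) where
  open Structure M

  no-separator : PreCoding M φ p d c → DisjointWitnesses M φ p d c → ¬ Separator φ
  no-separator (_ , ¬right , ¬left) (h , sat , disjoint , avoids-p) sep =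
    refute (S? zv) (hw , splice-holds M φ S? S-closed params-agree separated
                                      τ≡σ₀ τ≡σ₁ (sat 0 0) (sat 1 1))
    where
      open Separator sep

      σ : ℕ → Var n k l → Carrier
      σ = diagonal M p d c h

      spliced : Var n k l → Carrier
      spliced v = if does (S? v) then σ 0 v else σ 1 v

      hw : Vec Carrier k
      hw = tabulate (spliced ∘ wv)

      τ : Var n k l → Carrier
      τ = assign M (d 0) (d 1) (spliced zv) hw p

      spliced-inside : ∀ {v} → S v → spliced v ≡ σ 0 v
      spliced-inside {v} Sv rewrite dec-true (S? v) Sv = refl

      spliced-outside : ∀ {v} → ¬ S v → spliced v ≡ σ 1 v
      spliced-outside {v} ¬Sv rewrite dec-false (S? v) ¬Sv = refl

      τ≡σ₀ : ∀ {v} → S v → τ v ≡ σ 0 v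
      τ≡σ₀ {xv _} _  = refl
      τ≡σ₀ {yv j} Sv = contradiction Sv (y∉S j)
      τ≡σ₀ {zv}   Sv = spliced-inside Sv
      τ≡σ₀ {wv i} Sv = trans (lookup∘tabulate (spliced ∘ wv) i) (spliced-inside Sv)
      τ≡σ₀ {pv _} _  = refl

      τ≡σ₁ : ∀ {v} → ¬ S v → τ v ≡ σ 1 v
      τ≡σ₁ {xv i} ¬Sv = contradiction (x∈S i) ¬Sv
      τ≡σ₁ {yv _} _   = refl
      τ≡σ₁ {zv}   ¬Sv = spliced-outside ¬Sv
      τ≡σ₁ {wv i} ¬Sv = trans (lookup∘tabulate (spliced ∘ wv) i) (spliced-outside ¬Sv)
      τ≡σ₁ {pv _} _   = refl

      params-agree : ∀ {v} → IsParam v → σ 0 v ≡ σ 1 v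
      params-agree {pv _} _ = refl

      separated : ∀ {u v} → S u → ¬ S v → σ 0 u ≢ σ 1 v
      separated {v = v} Su _ =
        diagonals-disjoint M p d c h disjoint avoids-p {0} {1} (λ ()) {v = v} (S-params-free Su)

      refute : (z? : Dec (S zv)) →
               Satφ M φ p (d 0) (d 1) (if does z? then c 0 0 else c 1 1) → ⊥
      refute (yes _) = ¬right 0 0 1 z<s
      refute (no _)  = ¬left 1 1 0 z<s

module _ {L : Language} {n k l : ℕ} (φ : QPFormula L n k l) where

  EdgeAvoidingParams : Var n k l → Var n k l → Set
  EdgeAvoidingParams u v = ¬ IsParam v × Adj φ u v

  ReachableFromX : Var n k l → Set
  ReachableFromX v = ∃ λ i → ParamFreePath φ (xv i) v

  reachable : ClosedExtension EdgeAvoidingParams ReachableFromX (List.tabulate xv)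
  reachable = closedExtension
    (λ u v → Dec.¬? (isParam? v) Dec.×-dec adj? {φ = φ} u v)
    (λ { (i , path) (¬pv , u~v) → i , ParamFreePath-snoc path u~v ¬pv })
    allVars (List.tabulate xv) (inj₁ ∘ ∈-allVars)
    (AllP.tabulate⁺ λ i → i , here λ ())

  open ClosedExtension reachable

  reachable-separator : (∀ j → ¬ yv j ∈ members) → Separator φ
  reachable-separator y∉ = record
    { S             = _∈ members
    ; S?            = λ v → DecMem._∈?_ _≟V_ v members
    ; x∈S           = λ i → seeds⊆members (ListMem.∈-tabulate⁺ i)
    ; y∉S           = y∉
    ; S-params-free = λ v∈ → ParamFreePath-target (proj₂ (All.lookup members-sat v∈))
    ; S-closed      = λ u∈ u~v ¬pv → members-closed u∈ (¬pv , u~v)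
    }

  path-or-separator : (Σ (Fin n) λ i → Σ (Fin n) λ j → ParamFreePath φ (xv i) (yv j))
                      ⊎ Separator φ
  path-or-separator with Fin.any? (λ j → DecMem._∈?_ _≟V_ (yv j) members)
  ... | yes (j , y∈) = let i , path = All.lookup members-sat y∈ in inj₁ (i , j , path)
  ... | no y∉        = inj₂ (reachable-separator λ j y∈ → y∉ (j , y∈))

mainTheorem9 : (L : Language) (M : Structure L) (n k l : ℕ)
    (φ : QPFormula L n k l) (p : Vec (Structure.Carrier M) l)
    (d : ℕ → Vec (Structure.Carrier M) n) (c : ℕ → ℕ → Structure.Carrier M) →
    PreCoding M φ p d c →
    DisjointWitnesses M φ p d c →
    Σ (Fin n) λ i → Σ (Fin n) λ j → ParamFreePath φ (xv i) (yv j)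
mainTheorem9 L M n k l φ p d c precoding disjoint =
  [ id , ⊥-elim ∘ no-separator M φ p d c precoding disjoint ]′ (path-or-separator φ)
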